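{- Let $\lambda=(\lambda_1\ge\lambda_2\ge\dots\ge\lambda_m>0)$ be an integer partition, and let $\mathcal{O}\subset T([2])$ be the finite order ideal defined by $x_1^{\alpha_1}x_2^{\alpha_2}\in\mathcal{O}$ iff $\alpha_1<m$ and $\alpha_2<\lambda_{\alpha_1+1}$. Write $\mathrm{ind}_{\mathcal{O}}(i,j)$ for $\mathrm{ind}_{\mathcal{O}}(x_1^ix_2^j)$. Then for all integers $i,j,k,\ell\ge 0$: (1) if $i>m-1$ then $\mathrm{ind}_{\mathcal{O}}(i+k,j)=\mathrm{ind}_{\mathcal{O}}(i,j)+k$; (2) if $j>\lambda_1-1$ then $\mathrm{ind}_{\mathcal{O}}(i,j+k)=\mathrm{ind}_{\mathcal{O}}(i,j)+k$; (3) if $i>m-1$ and $j>\lambda_1-1$ then $\mathrm{ind}_{\mathcal{O}}(i+k,j+\ell)=\mathrm{ind}_{\mathcal{O}}(i,j)+k+\ell$.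
   Context: $T([2])=\{x_1^{a}x_2^{b}: a,b\in\mathbb{N}\}$, and $T([2])_k$ denotes the power products of total degree $k$. An order ideal $\mathcal{O}\subset T([2])$ is a set of power products closed under division. Its border is $\partial\mathcal{O}=(T([2])_1\cdot\mathcal{O})\setminus\mathcal{O}$ and closed border $\overline{\partial\mathcal{O}}=\partial\mathcal{O}\cup\mathcal{O}$; iterating, $\overline{\partial^0\mathcal{O}}=\mathcal{O}$, $\partial^k\mathcal{O}=\partial(\overline{\partial^{k-1}\mathcal{O}})$, $\overline{\partial^k\mathcal{O}}=\partial^k\mathcal{O}\cup\overline{\partial^{k-1}\mathcal{O}}$. The index $\mathrm{ind}_{\mathcal{O}}(t)$ is the least $k$ with $t\in\overline{\partial^k\mathcal{O}}$. -}

module Defs where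

open import Data.Nat using (ℕ; zero; suc; _<_; _>_; _≥_)
open import Data.Product using (_×_; _,_; ∃-syntax)
open import Data.Sum using (_⊎_)
open import Data.List using (List; []; _∷_; length)
open import Data.List.Relation.Unary.All using (All)
open import Data.List.Relation.Unary.Linked using (Linked)
open import Relation.Nullary using (¬_)
open import Relation.Binary.PropositionalEquality using (_≡_)

-- A power product x₁^a x₂^b ∈ T([2]) is represented by its exponent pair (a , b).
T2 : Set
T2 = ℕ × ℕ

PPSet : Set₁
PPSet = T2 → Set

MulVars : PPSet → PPSet
MulVars S (a , b) = (∃[ a' ] (a ≡ suc a' × S (a' , b)))
                  ⊎ (∃[ b' ] (b ≡ suc b' × S (a , b')))

border : PPSet → PPSet
border S t = MulVars S t × ¬ S t

closedBorder : PPSet → PPSet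
closedBorder S t = border S t ⊎ S t

closedBorderIter : ℕ → PPSet → PPSet
closedBorderIter zero    O = O
closedBorderIter (suc k) O = closedBorder (closedBorderIter k O)

IsIndex : PPSet → T2 → ℕ → Set
IsIndex O t k = closedBorderIter k O t × (∀ k' → k' < k → ¬ closedBorderIter k' O t)

IsPartition : List ℕ → Set
IsPartition l = Linked _≥_ l × All (λ x → x > 0) l

-- 0-based lookup with default 0 (only used at indices < length).
nth : List ℕ → ℕ → ℕ
nth []       _       = 0
nth (x ∷ l)  zero    = x
nth (x ∷ l)  (suc n) = nth l n

first : List ℕ → ℕ
first []      = 0
first (x ∷ l) = x

OrdIdeal : List ℕ → PPSet
OrdIdeal l (a₁ , a₂) = (a₁ < length l) × (a₂ < nth l a₁)

module Submission where

-- Fix a decidable set O of power products with 1 ∈ O and write C n = ∂̄ⁿO.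
-- Every closed border is obtained by multiplying with x₁ or x₂, so
-- (a,b) ∈ C (a + b); as membership in C n is decidable, every power
-- product has an index (the least such n).  The heart of the argument is a
-- peeling lemma: if the column {x₁^(i+1) x₂^b} misses O, then a point of
-- C (n+1) in column i+1 can only have entered by multiplication with x₁
-- (possibly after moving up inside that column), hence its left
-- neighbour already lies in C n.  Together with the obvious step
-- C n ∋ (i,j) ⇒ C (n+1) ∋ (i+1,j) this shows ind(i+1,j) = ind(i,j)+1, and
-- iterating gives part (1) for any O vanishing from column M on.  Part (2)
-- follows from part (1) by the symmetry x₁ ↔ x₂, which commutes with taking
-- closed borders; part (3) combines the two.  Finally the order ideal of a
-- partition λ is empty from column m and from row λ₁ on.

open import Defs
open import Function using (_∘_)
open import Data.Nat using (ℕ; zero; suc; _+_; _∸_; _<_; _≤_; _≥_; z≤n; s≤s; _<?_)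
open import Data.Nat.Properties
  using (≤-refl; ≤-trans; <-≤-trans; <-irrefl; +-suc; +-identityʳ; m≤m+n; m≤n⇒m≤1+n)
open import Data.Product using (_×_; _,_; ∃-syntax; swap)
open import Data.Sum using (inj₁; inj₂)
open import Data.List using (List; []; _∷_; length)
open import Data.List.Relation.Unary.All using (_∷_)
open import Data.List.Relation.Unary.Linked using (Linked; _∷_)
open import Data.Empty using (⊥-elim)
open import Relation.Nullary using (¬_; Dec; yes; no)
open import Relation.Nullary.Decidable using (_×-dec_; _⊎-dec_; ¬?)
open import Relation.Unary using (Decidable)
open import Relation.Binary.PropositionalEquality using (_≡_; refl; sym)

leastWitness : {P : ℕ → Set} → Decidable P →
               ∀ n → P n → ∃[ m ] (P m × (∀ k → k < m → ¬ P k))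
leastWitness P? n p with P? 0
... | yes p₀ = 0 , p₀ , λ _ ()
leastWitness P? zero    p | no ¬p₀ = ⊥-elim (¬p₀ p)
leastWitness {P} P? (suc n) p | no ¬p₀ with leastWitness (P? ∘ suc) n p
... | m , pm , below = suc m , pm , below′
  where
  below′ : ∀ k → k < suc m → ¬ P k
  below′ zero    _         = ¬p₀
  below′ (suc k) (s≤s k<m) = below k k<m

IsIndex-cong : ∀ {O a a′ b b′ d d′} → a ≡ a′ → b ≡ b′ → d ≡ d′ →
               IsIndex O (a , b) d → IsIndex O (a′ , b′) d′
IsIndex-cong refl refl refl ix = ix

closedBorderIter-swap : ∀ O n t → closedBorderIter n O t →
                        closedBorderIter n (O ∘ swap) (swap t)
closedBorderIter-swap O zero    t o        = o
closedBorderIter-swap O (suc n) t (inj₂ c) = inj₂ (closedBorderIter-swap O n t c)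
closedBorderIter-swap O (suc n) t (inj₁ (inj₁ (a , refl , c) , ∉)) =
  inj₁ (inj₂ (a , refl , closedBorderIter-swap O n _ c)
       , ∉ ∘ closedBorderIter-swap (O ∘ swap) n (swap t))
closedBorderIter-swap O (suc n) t (inj₁ (inj₂ (b , refl , c) , ∉)) =
  inj₁ (inj₁ (b , refl , closedBorderIter-swap O n _ c)
       , ∉ ∘ closedBorderIter-swap (O ∘ swap) n (swap t))

IsIndex-swap : ∀ O t d → IsIndex O t d → IsIndex (O ∘ swap) (swap t) d
IsIndex-swap O t d (c , below) =
  closedBorderIter-swap O d t c
  , λ k k<d c′ → below k k<d (closedBorderIter-swap (O ∘ swap) k (swap t) c′)

module Index (O : PPSet) (O? : Decidable O) where

  C : ℕ → PPSet
  C n = closedBorderIter n O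

  mulVars? : (S : PPSet) → Decidable S → Decidable (MulVars S)
  mulVars? S S? (a , b) = left a ⊎-dec below b
    where
    left : ∀ a → Dec (∃[ a′ ] (a ≡ suc a′ × S (a′ , b)))
    left zero     = no λ { (_ , () , _) }
    left (suc a′) with S? (a′ , b)
    ... | yes s = yes (a′ , refl , s)
    ... | no ¬s = no λ { (_ , refl , s) → ¬s s }
    below : ∀ b → Dec (∃[ b′ ] (b ≡ suc b′ × S (a , b′)))
    below zero     = no λ { (_ , () , _) }
    below (suc b′) with S? (a , b′)
    ... | yes s = yes (b′ , refl , s)
    ... | no ¬s = no λ { (_ , refl , s) → ¬s s }

  C? : ∀ n → Decidable (C n)
  C? zero    = O?
  C? (suc n) t = (mulVars? (C n) (C? n) t ×-dec ¬? (C? n t)) ⊎-dec C? n t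

  -- ∂̄S ⊇ T([2])₁ · S, which needs the decision whether t ∈ S already.
  mulVars⇒C : ∀ n t → MulVars (C n) t → C (suc n) t
  mulVars⇒C n t m with C? n t
  ... | yes c = inj₂ c
  ... | no ¬c = inj₁ (m , ¬c)

  step₁ : ∀ n a b → C n (a , b) → C (suc n) (suc a , b)
  step₁ n a b c = mulVars⇒C n _ (inj₁ (a , refl , c))

  step₂ : ∀ n a b → C n (a , b) → C (suc n) (a , suc b)
  step₂ n a b c = mulVars⇒C n _ (inj₂ (b , refl , c))

  reach : O (0 , 0) → ∀ a b → C (a + b) (a , b)
  reach o zero    zero    = o
  reach o zero    (suc b) = step₂ b 0 b (reach o 0 b)
  reach o (suc a) b       = step₁ (a + b) a b (reach o a b)

  index-exists : O (0 , 0) → ∀ a b → ∃[ d ] IsIndex O (a , b) d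
  index-exists o a b = leastWitness (λ n → C? n (a , b)) (a + b) (reach o a b)

  peel : ∀ i → (∀ b → ¬ O (suc i , b)) →
         ∀ n j → C (suc n) (suc i , j) → C n (i , j)
  peel i empty n       j (inj₁ (inj₁ (_ , refl , c) , _)) = c
  peel i empty zero    j (inj₁ (inj₂ (_ , refl , o) , _)) = ⊥-elim (empty _ o)
  peel i empty zero    j (inj₂ o)                          = ⊥-elim (empty j o)
  peel i empty (suc n) j (inj₁ (inj₂ (j′ , refl , c) , _)) = step₂ n i j′ (peel i empty n j′ c)
  peel i empty (suc n) j (inj₂ c)                          = inj₂ (peel i empty n j c)

  shift : ∀ i j d → (∀ b → ¬ O (suc i , b)) →
          IsIndex O (i , j) d → IsIndex O (suc i , j) (suc d)
  shift i j d empty (c , below) = step₁ d i j c , below′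
    where
    below′ : ∀ k → k < suc d → ¬ C k (suc i , j)
    below′ zero    _         = empty j
    below′ (suc k) (s≤s k<d) = below k k<d ∘ peel i empty k j

  shift-iter : ∀ M → (∀ a b → M ≤ a → ¬ O (a , b)) →
               ∀ i j d → M ≤ i → IsIndex O (i , j) d →
               ∀ k → IsIndex O (i + k , j) (d + k)
  shift-iter M vanish i j d M≤i ix zero =
    IsIndex-cong (sym (+-identityʳ i)) refl (sym (+-identityʳ d)) ix
  shift-iter M vanish i j d M≤i ix (suc k) =
    IsIndex-cong (sym (+-suc i k)) refl (sym (+-suc d k))
      (shift (i + k) j (d + k)
             (λ b → vanish _ b (m≤n⇒m≤1+n (≤-trans M≤i (m≤m+n i k))))
             (shift-iter M vanish i j d M≤i ix k))

shift-iter-row : ∀ O → Decidable O → ∀ M → (∀ a b → M ≤ b → ¬ O (a , b)) →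
                 ∀ i j d → M ≤ j → IsIndex O (i , j) d →
                 ∀ k → IsIndex O (i , j + k) (d + k)
shift-iter-row O O? M vanish i j d M≤j ix k =
  IsIndex-swap (O ∘ swap) _ _
    (Index.shift-iter (O ∘ swap) (O? ∘ swap) M (λ a b → vanish b a)
                      j i d M≤j (IsIndex-swap O _ _ ix) k)

OrdIdeal? : ∀ l → Decidable (OrdIdeal l)
OrdIdeal? l (a , b) = (a <? length l) ×-dec (b <? nth l a)

nth≤first : ∀ x l → Linked _≥_ (x ∷ l) → ∀ a → nth (x ∷ l) a ≤ x
nth≤first x l       _           zero    = ≤-refl
nth≤first x []      _           (suc a) = z≤n
nth≤first x (y ∷ l) (x≥y ∷ lin) (suc a) = ≤-trans (nth≤first y l lin a) x≥y

beyondColumns : ∀ l a b → length l ≤ a → ¬ OrdIdeal l (a , b)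
beyondColumns l a b m≤a (a<m , _) = <-irrefl refl (<-≤-trans a<m m≤a)

beyondRows : ∀ x l → Linked _≥_ (x ∷ l) →
             ∀ a b → x ≤ b → ¬ OrdIdeal (x ∷ l) (a , b)
beyondRows x l lin a b x≤b (_ , b<λ) =
  <-irrefl refl (<-≤-trans b<λ (≤-trans (nth≤first x l lin a) x≤b))

-- The hypothesis "j > λ₁ - 1" of the statement, in the form λ₁ ≤ j.
∸1<⇒≤ : ∀ n j → n ∸ 1 < j → n ≤ j
∸1<⇒≤ zero    j _ = z≤n
∸1<⇒≤ (suc n) j p = p

module PartitionIdeal (l₁ : ℕ) (rest : List ℕ) (lin : Linked _≥_ (l₁ ∷ rest)) where

  columns : ∀ {i j d} → length (l₁ ∷ rest) ≤ i → IsIndex (OrdIdeal (l₁ ∷ rest)) (i , j) d →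
            ∀ k → IsIndex (OrdIdeal (l₁ ∷ rest)) (i + k , j) (d + k)
  columns {i} {j} {d} m≤i =
    Index.shift-iter (OrdIdeal (l₁ ∷ rest)) (OrdIdeal? (l₁ ∷ rest))
      (length (l₁ ∷ rest)) (beyondColumns (l₁ ∷ rest)) i j d m≤i

  rows : ∀ {i j d} → l₁ ≤ j → IsIndex (OrdIdeal (l₁ ∷ rest)) (i , j) d →
         ∀ k → IsIndex (OrdIdeal (l₁ ∷ rest)) (i , j + k) (d + k)
  rows {i} {j} {d} λ₁≤j =
    shift-iter-row (OrdIdeal (l₁ ∷ rest)) (OrdIdeal? (l₁ ∷ rest))
      l₁ (beyondRows l₁ rest lin) i j d λ₁≤j

mainTheorem2 : (l₁ : ℕ) (rest : List ℕ) → IsPartition (l₁ ∷ rest) →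
    (i j k ℓ : ℕ) →
    ((length (l₁ ∷ rest) ∸ 1 < i) → ∃[ d ] (IsIndex (OrdIdeal (l₁ ∷ rest)) (i , j) d × IsIndex (OrdIdeal (l₁ ∷ rest)) (i + k , j) (d + k)))
    × ((l₁ ∸ 1 < j) → ∃[ d ] (IsIndex (OrdIdeal (l₁ ∷ rest)) (i , j) d × IsIndex (OrdIdeal (l₁ ∷ rest)) (i , j + k) (d + k)))
    × ((length (l₁ ∷ rest) ∸ 1 < i) → (l₁ ∸ 1 < j) → ∃[ d ] (IsIndex (OrdIdeal (l₁ ∷ rest)) (i , j) d × IsIndex (OrdIdeal (l₁ ∷ rest)) (i + k , j + ℓ) (d + k + ℓ)))
mainTheorem2 l₁ rest (lin , l₁>0 ∷ _) i j k ℓ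
  with Index.index-exists (OrdIdeal (l₁ ∷ rest)) (OrdIdeal? (l₁ ∷ rest)) (s≤s z≤n , l₁>0) i j
... | d , ix =
  (λ i>m-1 → d , ix , columns i>m-1 ix k) ,
  (λ j>λ₁-1 → d , ix , rows (∸1<⇒≤ l₁ j j>λ₁-1) ix k) ,
  (λ i>m-1 j>λ₁-1 → d , ix , rows (∸1<⇒≤ l₁ j j>λ₁-1) (columns i>m-1 ix k) ℓ)
  where open PartitionIdeal l₁ rest lin
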